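{- Let $G\le\Sigma_d$ be a transitive permutation group on $\Omega_d=\{1,\dots,d\}$ and let $\alpha\in G$ have disjoint cycle decomposition (including cycles of length 1) \[ \alpha=(i^1_1,\dots,i^1_{n_1})(i^2_1,\dots,i^2_{n_2})\cdots(i^l_1,\dots,i^l_{n_l}), \] with $S^r=\{i^r_1,\dots,i^r_{n_r}\}$ for $1\le r\le l$. Let $A$ be a proper subset of $\Omega_d$ such that there are distinct $s,t\in\{1,\dots,l\}$ with $\gcd(n_s,n_t)=1$, \[ \emptyset\ne S^s\setminus A\subsetneq S^s\quad\text{and}\quad S^t\cap A\ne\emptyset. \] Then $A$ is not a block for $G$.
   Context: A set $B\subseteq\Omega_d$ is a block for $G$ if for every $\gamma\in G$ either $\gamma B=B$ or $\gamma B\cap B=\emptyset$. -}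

module Defs where

open import Level using (Level; suc; _⊔_) renaming (zero to lzero)
open import Data.Nat using (ℕ; zero; suc; _<_)
open import Data.Nat.GCD using (gcd)
open import Data.Fin using (Fin)
open import Data.Fin.Permutation using (Permutation′; _⟨$⟩ʳ_; _∘ₚ_; id; flip)
open import Data.Fin.Subset using (Subset; _∈_; _∉_)
open import Data.Product using (Σ; ∃; _×_; _,_)
open import Data.Sum using (_⊎_)
open import Relation.Binary.PropositionalEquality using (_≡_; _≢_)
open import Relation.Nullary using (¬_)
open import Function.Bundles using (_⇔_)

record PermGroup (d : ℕ) : Set₁ where
  field
    _∈G : Permutation′ d → Set
    resp  : ∀ {σ τ} → (∀ i → σ ⟨$⟩ʳ i ≡ τ ⟨$⟩ʳ i) → σ ∈G → τ ∈G
    id∈   : id ∈G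
    ∘∈    : ∀ {σ τ} → σ ∈G → τ ∈G → (σ ∘ₚ τ) ∈G
    inv∈  : ∀ {σ} → σ ∈G → flip σ ∈G
open PermGroup public

IsTransitive : ∀ {d} → PermGroup d → Set
IsTransitive {d} G = ∀ (i j : Fin d) → Σ (Permutation′ d) λ γ → _∈G G γ × γ ⟨$⟩ʳ i ≡ j

pow : ∀ {d} → Permutation′ d → ℕ → Fin d → Fin d
pow α zero    x = x
pow α (suc k) x = α ⟨$⟩ʳ pow α k x

InCycle : ∀ {d} → Permutation′ d → Fin d → Fin d → Set
InCycle α x z = ∃ λ k → pow α k x ≡ z

CycleLength : ∀ {d} → Permutation′ d → Fin d → ℕ → Set
CycleLength α x n = 0 < n × pow α n x ≡ x × (∀ k → 0 < k → k < n → pow α k x ≢ x)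

ImageMem : ∀ {d} → Permutation′ d → Subset d → Fin d → Set
ImageMem γ B z = ∃ λ b → b ∈ B × γ ⟨$⟩ʳ b ≡ z

IsBlock : ∀ {d} → PermGroup d → Subset d → Set
IsBlock {d} G B = ∀ γ → _∈G G γ →
  (∀ z → ImageMem γ B z ⇔ z ∈ B) ⊎ (∀ z → ¬ (ImageMem γ B z × z ∈ B))

-- α^nₜ lies in G and fixes the cycle of α through y pointwise, so it moves a point of A
-- into A; as A is a block, α^nₜ maps A into itself.  Since gcd nₛ nₜ = 1, the powers of
-- α^nₜ act transitively on the cycle of α through x (Bézout), so A, which meets that
-- cycle, contains all of it — contradicting that A misses a point of it.
module Submission where

open import Defs
open import Data.Nat using (ℕ; zero; suc; _+_; _*_; _<_)
open import Data.Nat.GCD using (gcd; module Bézout)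
open import Data.Nat.Coprimality using (coprime-Bézout; gcd≡1⇒coprime)
open import Data.Nat.Properties using (+-comm; +-assoc)
open import Data.Nat.Tactic.RingSolver using (solve-∀)
open import Data.Fin using (Fin)
open import Data.Fin.Permutation using (Permutation′; _⟨$⟩ʳ_; _∘ₚ_; id)
open import Data.Fin.Subset using (Subset; _∈_; _∉_; _⊂_; ⊤)
open import Data.Empty using (⊥-elim)
open import Data.Product using (∃; ∃-syntax; _×_; _,_)
open import Data.Sum using (inj₁; inj₂)
open import Function.Bundles using (Equivalence)
open import Relation.Binary.PropositionalEquality
  using (_≡_; refl; sym; trans; cong; subst; module ≡-Reasoning)
open import Relation.Nullary using (¬_)

open Bézout.Identity using (Identity; +-; -+)

coprime⇒multiple-hits-residue : ∀ {n t} → 0 < n → Identity 1 n t →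
  ∀ c → ∃[ m ] ∃[ q ] ∃[ r ] m * t + r * n ≡ c + q * n
coprime⇒multiple-hits-residue {n} {t} _ (-+ x y 1+xn≡yt) c =
  c * y , c * x , 0 , (begin
    c * y * t + 0 * n   ≡⟨ regroup c y t n ⟩
    c * (y * t)         ≡⟨ cong (c *_) (sym 1+xn≡yt) ⟩
    c * (1 + x * n)     ≡⟨ expand c x n ⟩
    c + c * x * n       ∎)
  where
  open ≡-Reasoning
  regroup : ∀ c y t n → c * y * t + 0 * n ≡ c * (y * t)
  regroup = solve-∀
  expand : ∀ c x n → c * (1 + x * n) ≡ c + c * x * n
  expand = solve-∀
-- Here y t ≡ −1 (mod n), so m = c (n − 1) y gives m t ≡ c.
coprime⇒multiple-hits-residue {suc n′} {t} _ (+- x y 1+yt≡xn) c =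
  c * n′ * y , c * n′ * x , c , (begin
    c * n′ * y * t + c * suc n′  ≡⟨ regroup c n′ y t ⟩
    c * n′ * (1 + y * t) + c     ≡⟨ cong (λ w → c * n′ * w + c) 1+yt≡xn ⟩
    c * n′ * (x * suc n′) + c    ≡⟨ reorder c n′ x ⟩
    c + c * n′ * x * suc n′      ∎)
  where
  open ≡-Reasoning
  regroup : ∀ c n′ y t → c * n′ * y * t + c * suc n′ ≡ c * n′ * (1 + y * t) + c
  regroup = solve-∀
  reorder : ∀ c n′ x → c * n′ * (x * suc n′) + c ≡ c + c * n′ * x * suc n′
  reorder = solve-∀

coprime⇒multiple-shifts-residue : ∀ {n t} → 0 < n → Identity 1 n t →
  ∀ a b → ∃[ m ] ∃[ q ] ∃[ r ] a + m * t + r * n ≡ b + q * n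
-- a + (b + a (n − 1)) ≡ b (mod n).
coprime⇒multiple-shifts-residue {suc n′} {t} 0<n bézout a b
  with coprime⇒multiple-hits-residue 0<n bézout (b + a * n′)
... | m , q , r , mt+rn≡c+qn = m , a + q , r , (begin
    a + m * t + r * suc n′        ≡⟨ +-assoc a (m * t) (r * suc n′) ⟩
    a + (m * t + r * suc n′)      ≡⟨ cong (a +_) mt+rn≡c+qn ⟩
    a + (b + a * n′ + q * suc n′) ≡⟨ collect a b n′ q ⟩
    b + (a + q) * suc n′          ∎)
  where
  open ≡-Reasoning
  collect : ∀ a b n′ q → a + (b + a * n′ + q * suc n′) ≡ b + (a + q) * suc n′
  collect = solve-∀

module _ {d} (α : Permutation′ d) where

  pow-+ : ∀ i j x → pow α (i + j) x ≡ pow α i (pow α j x)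
  pow-+ zero    j x = refl
  pow-+ (suc i) j x = cong (α ⟨$⟩ʳ_) (pow-+ i j x)

  pow-comm : ∀ i j x → pow α i (pow α j x) ≡ pow α j (pow α i x)
  pow-comm i j x = begin
    pow α i (pow α j x) ≡⟨ sym (pow-+ i j x) ⟩
    pow α (i + j) x     ≡⟨ cong (λ k → pow α k x) (+-comm i j) ⟩
    pow α (j + i) x     ≡⟨ pow-+ j i x ⟩
    pow α j (pow α i x) ∎
    where open ≡-Reasoning

  pow-*-periodic : ∀ {n x} → pow α n x ≡ x → ∀ q → pow α (q * n) x ≡ x
  pow-*-periodic         αⁿx≡x zero    = refl
  pow-*-periodic {n} {x} αⁿx≡x (suc q) = begin
    pow α (n + q * n) x       ≡⟨ pow-+ n (q * n) x ⟩
    pow α n (pow α (q * n) x) ≡⟨ cong (pow α n) (pow-*-periodic αⁿx≡x q) ⟩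
    pow α n x                 ≡⟨ αⁿx≡x ⟩
    x                         ∎
    where open ≡-Reasoning

  pow-+-period : ∀ {n x} → pow α n x ≡ x → ∀ i q → pow α (i + q * n) x ≡ pow α i x
  pow-+-period {n} {x} αⁿx≡x i q =
    trans (pow-+ i (q * n) x) (cong (pow α i) (pow-*-periodic αⁿx≡x q))

  periodic-on-cycle : ∀ {n y z} → pow α n y ≡ y → InCycle α y z → pow α n z ≡ z
  periodic-on-cycle {n} {y} αⁿy≡y (k , refl) =
    trans (pow-comm n k y) (cong (pow α k) αⁿy≡y)

  pow-*-closed : ∀ {t} (A : Subset d) → (∀ z → z ∈ A → pow α t z ∈ A) →
    ∀ m z → z ∈ A → pow α (m * t) z ∈ A
  pow-*-closed     A closed zero    z z∈A = z∈A
  pow-*-closed {t} A closed (suc m) z z∈A =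
    subst (_∈ A) (sym (pow-+ t (m * t) z)) (closed _ (pow-*-closed A closed m z z∈A))

  coprime-power-invariant⇒cycle⊆ : ∀ {n t x} (A : Subset d) →
    0 < n → pow α n x ≡ x → gcd n t ≡ 1 → (∀ z → z ∈ A → pow α t z ∈ A) →
    ∀ {z w} → InCycle α x z → InCycle α x w → z ∈ A → w ∈ A
  coprime-power-invariant⇒cycle⊆ {n} {t} {x} A 0<n αⁿx≡x gcd≡1 closed (a , refl) (b , refl) αᵃx∈A
    with coprime⇒multiple-shifts-residue 0<n (coprime-Bézout (gcd≡1⇒coprime gcd≡1)) a b
  ... | m , q , r , a+mt+rn≡b+qn =
    subst (_∈ A) αᵐᵗαᵃx≡αᵇx (pow-*-closed A closed m (pow α a x) αᵃx∈A)
    where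
    open ≡-Reasoning
    αᵐᵗαᵃx≡αᵇx : pow α (m * t) (pow α a x) ≡ pow α b x
    αᵐᵗαᵃx≡αᵇx = begin
      pow α (m * t) (pow α a x)      ≡⟨ pow-comm (m * t) a x ⟩
      pow α a (pow α (m * t) x)      ≡⟨ sym (pow-+ a (m * t) x) ⟩
      pow α (a + m * t) x            ≡⟨ sym (pow-+-period αⁿx≡x (a + m * t) r) ⟩
      pow α (a + m * t + r * n) x    ≡⟨ cong (λ k → pow α k x) a+mt+rn≡b+qn ⟩
      pow α (b + q * n) x            ≡⟨ pow-+-period αⁿx≡x b q ⟩
      pow α b x                      ∎

_^ₚ_ : ∀ {d} → Permutation′ d → ℕ → Permutation′ d
α ^ₚ zero    = id
α ^ₚ (suc k) = (α ^ₚ k) ∘ₚ α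

^ₚ-apply : ∀ {d} (α : Permutation′ d) k i → (α ^ₚ k) ⟨$⟩ʳ i ≡ pow α k i
^ₚ-apply α zero    i = refl
^ₚ-apply α (suc k) i = cong (α ⟨$⟩ʳ_) (^ₚ-apply α k i)

^ₚ∈G : ∀ {d} (G : PermGroup d) {α} → _∈G G α → ∀ k → _∈G G (α ^ₚ k)
^ₚ∈G G α∈G zero    = id∈ G
^ₚ∈G G α∈G (suc k) = ∘∈ G (^ₚ∈G G α∈G k) α∈G

block-meeting-image⇒invariant : ∀ {d} (G : PermGroup d) {B : Subset d} → IsBlock G B →
  ∀ {γ} → _∈G G γ → ∀ {b} → b ∈ B → γ ⟨$⟩ʳ b ∈ B → ∀ {z} → z ∈ B → γ ⟨$⟩ʳ z ∈ B
block-meeting-image⇒invariant G B-block γ∈G {b} b∈B γb∈B {z} z∈B with B-block _ γ∈G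
... | inj₁ γB≡B    = Equivalence.to (γB≡B _) (z , z∈B , refl)
... | inj₂ γB∩B≡∅ = ⊥-elim (γB∩B≡∅ _ ((b , b∈B , refl) , γb∈B))

mainTheorem2 : ∀ {d : ℕ} (G : PermGroup d) → IsTransitive G →
    (α : Permutation′ d) → _∈G G α →
    (A : Subset d) → A ⊂ ⊤ →
    (x y : Fin d) → ¬ InCycle α x y →
    (nₛ nₜ : ℕ) → CycleLength α x nₛ → CycleLength α y nₜ → gcd nₛ nₜ ≡ 1 →
    (∃ λ z → InCycle α x z × z ∉ A) →
    (∃ λ z → InCycle α x z × z ∈ A) →
    (∃ λ z → InCycle α y z × z ∈ A) →
    ¬ IsBlock G A
mainTheorem2 G _ α α∈G A _ x y _ nₛ nₜ (0<nₛ , αⁿˢx≡x , _) (_ , αⁿᵗy≡y , _) gcd≡1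
  (u , u∈Sₛ , u∉A) (v , v∈Sₛ , v∈A) (w , w∈Sₜ , w∈A) A-block =
  u∉A (coprime-power-invariant⇒cycle⊆ α A 0<nₛ αⁿˢx≡x gcd≡1 αⁿᵗ-preserves-A v∈Sₛ u∈Sₛ v∈A)
  where
  αⁿᵗ-fixes-w : (α ^ₚ nₜ) ⟨$⟩ʳ w ≡ w
  αⁿᵗ-fixes-w = trans (^ₚ-apply α nₜ w) (periodic-on-cycle α {nₜ} αⁿᵗy≡y w∈Sₜ)

  αⁿᵗ-preserves-A : ∀ z → z ∈ A → pow α nₜ z ∈ A
  αⁿᵗ-preserves-A z z∈A = subst (_∈ A) (^ₚ-apply α nₜ z)
    (block-meeting-image⇒invariant G A-block (^ₚ∈G G α∈G nₜ) w∈A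
      (subst (_∈ A) (sym αⁿᵗ-fixes-w) w∈A) z∈A)
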